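{- Let $\mathbb{F}$ be any field. For all $n, d \in \mathbb{N}$ there is a polynomial map $P : \mathbb{F}^{n^d/100} \to \mathbb{F}^{n^d}$, each of whose coordinates is a polynomial of degree at most $d$, such that every $d$-dimensional tensor $\tau : [n]^d \to \mathbb{F}$ of rank at most $n^{d-1}/(100d)$ lies in its image.
   Context: The rank of a tensor $\tau : [n]^d \to \mathbb{F}$ is the minimum $r$ such that $\tau = \sum_{i=1}^r a_{i,1}\otimes\cdots\otimes a_{i,d}$ with all $a_{i,j}\in\mathbb{F}^n$. Tensors $[n]^d \to \mathbb{F}$ are identified with $\mathbb{F}^{n^d}$. -}

module Defs where

open import Level using (Level; _⊔_)
open import Algebra.Bundles using (CommutativeRing)
open import Data.Nat using (ℕ; zero; suc)
open import Data.Fin using (Fin)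
import Data.Fin as Fin
open import Data.Maybe using (Maybe; just; nothing)
open import Data.List using (List; []; _∷_)
open import Data.Product using (Σ; ∃; _×_; _,_)
open import Relation.Nullary using (¬_)

record Field (c ℓ : Level) : Set (Level.suc (c ⊔ ℓ)) where
  field
    commutativeRing : CommutativeRing c ℓ
  open CommutativeRing commutativeRing public
  field
    0≉1     : ¬ (0# ≈ 1#)
    inverse : ∀ x → ¬ (x ≈ 0#) → Σ Carrier λ y → x * y ≈ 1#

module _ {c ℓ} (F : Field c ℓ) where
  open Field F

  sumFin : ∀ k → (Fin k → Carrier) → Carrier
  sumFin zero    f = 0#
  sumFin (suc k) f = f Fin.zero + sumFin k (λ i → f (Fin.suc i))

  prodFin : ∀ k → (Fin k → Carrier) → Carrier
  prodFin zero    f = 1#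
  prodFin (suc k) f = f Fin.zero * prodFin k (λ i → f (Fin.suc i))

  Tensor : ℕ → ℕ → Set c
  Tensor n d = (Fin d → Fin n) → Carrier

  RankAtMost : ∀ {n d} → Tensor n d → ℕ → Set (c ⊔ ℓ)
  RankAtMost {n} {d} τ r =
    Σ (Fin r → Fin d → Fin n → Carrier) λ a →
      ∀ (idx : Fin d → Fin n) →
        τ idx ≈ sumFin r (λ i → prodFin d (λ j → a i j (idx j)))

  -- A monomial in m variables of degree ≤ D: a product of D factors, each
  -- either a variable x_k (just k) or the constant 1 (nothing).
  Monomial : ℕ → ℕ → Set
  Monomial m D = Fin D → Maybe (Fin m)

  evalMonomial : ∀ {m D} → Monomial m D → (Fin m → Carrier) → Carrier
  evalMonomial {m} {D} μ x = prodFin D λ j → factor (μ j)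
    where
      factor : Maybe (Fin m) → Carrier
      factor (just k) = x k
      factor nothing  = 1#

  Poly : ℕ → ℕ → Set c
  Poly m D = List (Carrier × Monomial m D)

  evalPoly : ∀ {m D} → Poly m D → (Fin m → Carrier) → Carrier
  evalPoly []             x = 0#
  evalPoly ((a , μ) ∷ p) x = a * evalMonomial μ x + evalPoly p x

  -- A polynomial map F^m → F^{[n]^d} (≅ F^{n^d}) with every coordinate a
  -- polynomial of degree ≤ D.
  PolyMap : ℕ → ℕ → ℕ → ℕ → Set c
  PolyMap m n d D = (Fin d → Fin n) → Poly m D

  InImage : ∀ {m n d D} → PolyMap m n d D → Tensor n d → Set (c ⊔ ℓ)
  InImage {m} P τ =
    Σ (Fin m → Carrier) λ x → ∀ idx → evalPoly (P idx) x ≈ τ idx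

module Submission where

-- A tensor of rank ≤ R is  τ(idx) = Σ_{i<R} Π_{j<d} b_{i,j}(idx j)
-- for factor vectors b_{i,j} ∈ F^n.  Treat all R·d·n entries of the b's as
-- independent variables: the map
--     P(x)(idx) = Σ_{i<R} Π_{j<d} x_{(i, j, idx j)}
-- has coordinates that are sums of degree-d monomials, and every tensor of
-- rank ≤ R is P(x) for x listing the entries of its factor vectors; a tensor
-- of rank r ≤ R has rank ≤ R by adding zero terms (which vanish as d ≥ 1).  It only
-- remains to choose R with R·d·n ≤ n^d/100 and r ≤ R whenever
-- 100·d·r ≤ n^{d-1}; R = ⌊n^{d-1}/(100d)⌋ works.

open import Defs
open import Data.Nat using (ℕ; _*_; _^_; _∸_; _≤_; _/_)
open import Data.Product using (Σ)

open import Data.Nat using (zero; suc; s≤s; z≤n; NonZero)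
import Data.Nat.Properties as ℕP
open import Data.Nat.DivMod using (m/n*n≤m; m*n/n≡m; /-monoˡ-≤)
open import Data.Nat.Solver using (module +-*-Solver)
open import Data.Fin using (Fin; inject≤; combine; remQuot)
import Data.Fin as Fin
open import Data.Fin.Properties using (remQuot-combine)
open import Data.List using ([]; _∷_)
open import Data.Maybe using (just)
open import Data.Product using (_,_; _×_; proj₁; proj₂)
open import Relation.Binary.PropositionalEquality as ≡ using (_≡_)

pad : ∀ {a} {A : Set a} {r R} → (Fin r → A) → A → r ≤ R → Fin R → A
pad {r = zero}  f z _       _           = z
pad {r = suc r} f z (s≤s p) Fin.zero    = f Fin.zero
pad {r = suc r} f z (s≤s p) (Fin.suc i) = pad (λ i → f (Fin.suc i)) z p i

pad-inject≤ : ∀ {a} {A : Set a} {r R} (f : Fin r → A) (z : A) (p : r ≤ R)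
  (i : Fin r) → pad f z p (inject≤ i p) ≡ f i
pad-inject≤ f z (s≤s p) Fin.zero    = ≡.refl
pad-inject≤ f z (s≤s p) (Fin.suc i) = pad-inject≤ (λ i → f (Fin.suc i)) z p i

module FieldFacts {c ℓ} (F : Field c ℓ) where
  open Field F hiding (_*_)

  sumFin-cong : ∀ k {f g : Fin k → Carrier} → (∀ i → f i ≈ g i) →
    sumFin F k f ≈ sumFin F k g
  sumFin-cong zero    f≈g = refl
  sumFin-cong (suc k) f≈g = +-cong (f≈g Fin.zero) (sumFin-cong k (λ i → f≈g (Fin.suc i)))

  prodFin-cong : ∀ k {f g : Fin k → Carrier} → (∀ i → f i ≈ g i) →
    prodFin F k f ≈ prodFin F k g
  prodFin-cong zero    f≈g = refl
  prodFin-cong (suc k) f≈g = *-cong (f≈g Fin.zero) (prodFin-cong k (λ i → f≈g (Fin.suc i)))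

  sumFin-zero : ∀ k {f : Fin k → Carrier} → (∀ i → f i ≈ 0#) → sumFin F k f ≈ 0#
  sumFin-zero zero    f≈0 = refl
  sumFin-zero (suc k) f≈0 =
    trans (+-cong (f≈0 Fin.zero) (sumFin-zero k (λ i → f≈0 (Fin.suc i)))) (+-identityˡ 0#)

  sumFin-pad : ∀ {A : Set c} {r R} (f : Fin r → A) (z : A) (p : r ≤ R)
    (h : A → Carrier) → h z ≈ 0# →
    sumFin F R (λ i → h (pad f z p i)) ≈ sumFin F r (λ i → h (f i))
  sumFin-pad {r = zero}  {R} f z p       h hz = sumFin-zero R (λ _ → hz)
  sumFin-pad {r = suc r}     f z (s≤s p) h hz =
    +-cong refl (sumFin-pad (λ i → f (Fin.suc i)) z p h hz)

  -- Rank is monotone: a rank-r decomposition becomes a rank-R one by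
  -- appending terms with zero factors (these vanish since d ≥ 1).
  rankAtMost-mono : ∀ {n d'} {τ : Tensor F n (suc d')} {r R} → r ≤ R →
    RankAtMost F τ r → RankAtMost F τ R
  rankAtMost-mono {d' = d'} r≤R (a , τ≡) =
    pad a (λ _ _ → 0#) r≤R ,
    λ idx → trans (τ≡ idx) (sym (sumFin-pad a _ r≤R (term idx) (zeroˡ _)))
    where
    term : ∀ {n} → (Fin (suc d') → Fin n) → (Fin (suc d') → Fin n → Carrier) → Carrier
    term idx b = prodFin F (suc d') (λ j → b j (idx j))

  sumOfMonomials : ∀ {m D} R → (Fin R → Monomial F m D) → Poly F m D
  sumOfMonomials zero    μ = []
  sumOfMonomials (suc R) μ = (1# , μ Fin.zero) ∷ sumOfMonomials R (λ i → μ (Fin.suc i))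

  evalPoly-sumOfMonomials : ∀ {m D} R (μ : Fin R → Monomial F m D) x →
    evalPoly F (sumOfMonomials R μ) x ≈ sumFin F R (λ i → evalMonomial F (μ i) x)
  evalPoly-sumOfMonomials zero    μ x = refl
  evalPoly-sumOfMonomials (suc R) μ x =
    +-cong (*-identityˡ _) (evalPoly-sumOfMonomials R (λ i → μ (Fin.suc i)) x)

module UniversalMap {c ℓ} (F : Field c ℓ) (n d R m : ℕ) (room : R * (d * n) ≤ m) where
  open Field F hiding (_*_)
  open FieldFacts F

  -- The variable holding the entry k of the j-th factor vector of term i.
  var : Fin R → Fin d → Fin n → Fin m
  var i j k = inject≤ (combine i (combine j k)) room

  universalMap : PolyMap F m n d d
  universalMap idx = sumOfMonomials R (λ i j → just (var i j (idx j)))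

  entries : (Fin R → Fin d → Fin n → Carrier) → Fin R × Fin (d * n) → Carrier
  entries b (i , w) = b i (proj₁ (remQuot {d} n w)) (proj₂ (remQuot {d} n w))

  assignment : (Fin R → Fin d → Fin n → Carrier) → Fin m → Carrier
  assignment b = pad (λ v → entries b (remQuot (d * n) v)) 0# room

  assignment-var : ∀ b i j k → assignment b (var i j k) ≡ b i j k
  assignment-var b i j k = begin
    assignment b (var i j k)
      ≡⟨ pad-inject≤ (λ v → entries b (remQuot (d * n) v)) 0# room (combine i (combine j k)) ⟩
    entries b (remQuot (d * n) (combine i (combine j k)))
      ≡⟨ ≡.cong (entries b) (remQuot-combine {R} {d * n} i (combine j k)) ⟩
    entries b (i , combine j k)
      ≡⟨ ≡.cong (λ jk → b i (proj₁ jk) (proj₂ jk)) (remQuot-combine {d} {n} j k) ⟩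
    b i j k ∎
    where open ≡.≡-Reasoning

  rank≤R⇒inImage : ∀ (τ : Tensor F n d) → RankAtMost F τ R → InImage F universalMap τ
  rank≤R⇒inImage τ (b , τ≡) = assignment b , λ idx →
    trans (evalPoly-sumOfMonomials R _ (assignment b))
      (trans (sumFin-cong R (λ i → prodFin-cong d (λ j →
                reflexive (assignment-var b i j (idx j)))))
        (sym (τ≡ idx)))

*≤⇒≤/ : ∀ {m o k} .{{_ : NonZero o}} → m * o ≤ k → m ≤ k / o
*≤⇒≤/ {m} {o} m*o≤k = ≡.subst (_≤ _) (m*n/n≡m m o) (/-monoˡ-≤ o m*o≤k)

module Parameters (c n d' : ℕ) .{{_ : NonZero c}} where
  d = suc d'

  instance
    c*d≢0 : NonZero (c * d)
    c*d≢0 = ℕP.m*n≢0 c d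

  terms : ℕ
  terms = n ^ d' / (c * d)

  terms-fit : terms * (d * n) ≤ n ^ d / c
  terms-fit = *≤⇒≤/ (≡.subst (_≤ n ^ d) reorder (ℕP.*-monoʳ-≤ n (m/n*n≤m (n ^ d') (c * d))))
    where
    open +-*-Solver
    reorder : n * (terms * (c * d)) ≡ terms * (d * n) * c
    reorder = solve 4 (λ n R d c → n :* (R :* (c :* d)) := R :* (d :* n) :* c)
                ≡.refl n terms d c

  rank-bound : ∀ r → c * d * r ≤ n ^ d' → r ≤ terms
  rank-bound r cdr≤ = *≤⇒≤/ (≡.subst (_≤ n ^ d') (ℕP.*-comm (c * d) r) cdr≤)

lemma4p3 : ∀ {c ℓ} (F : Field c ℓ) (n d : ℕ) → 1 ≤ d →
    Σ (PolyMap F ((n ^ d) / 100) n d d) λ P →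
    ∀ (τ : Tensor F n d) (r : ℕ) →
    100 * d * r ≤ n ^ (d ∸ 1) →
    RankAtMost F τ r →
    InImage F P τ
lemma4p3 F n (suc d') (s≤s z≤n) =
  universalMap , λ τ r r-small rank≤r →
    rank≤R⇒inImage τ (rankAtMost-mono (rank-bound r r-small) rank≤r)
  where
  open Parameters 100 n d'
  open FieldFacts F using (rankAtMost-mono)
  open UniversalMap F n (suc d') terms (n ^ suc d' / 100) terms-fit
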